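{- Let $k\le l$ be positive integers with $\gcd(k,l)=1$, let $n\ge1$ and $m\ge0$ be integers, and write $m=qn+r$ with integers $q\ge0$, $0\le r<n$. Then $$U^{k,l}(m,n)= \max\bigl(nkq,\ nkq+r(k+l)-nl\bigr).$$
   Context: $\mathcal D^{k,l}(m,n)$ denotes the set of all $nk\times nl$ matrices with nonnegative integer entries all of whose row sums equal $ml$ and all of whose column sums equal $mk$. For an $s\times t$ matrix $A$ with $s\le t$, a transversal is a set of $s$ entries of $A$, one from each row, no two in the same column; $|T|$ denotes the sum of the entries of a transversal $T$. Define ${\rm tropdet}(A)=\min_T|T|$ over all transversals $T$ of $A$, and $U^{k,l}(m,n)=\max_{A\in\mathcal D^{k,l}(m,n)}{\rm tropdet}(A)$. -}

module Defs where

open import Data.Nat using (ℕ; zero; suc; _+_; _*_; _≤_)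
open import Data.Fin using (Fin; zero; suc)
open import Data.Product using (Σ; _×_; ∃; _,_)
open import Relation.Binary.PropositionalEquality using (_≡_)
open import Function.Definitions using (Injective)

sumFin : (n : ℕ) → (Fin n → ℕ) → ℕ
sumFin zero    f = 0
sumFin (suc n) f = f zero + sumFin n (λ i → f (suc i))

Matrix : ℕ → ℕ → Set
Matrix s t = Fin s → Fin t → ℕ

InD : (k l m n : ℕ) → Matrix (n * k) (n * l) → Set
InD k l m n A =
  ((i : Fin (n * k)) → sumFin (n * l) (λ j → A i j) ≡ m * l) ×
  ((j : Fin (n * l)) → sumFin (n * k) (λ i → A i j) ≡ m * k)

Transversal : ℕ → ℕ → Set
Transversal s t = Σ (Fin s → Fin t) (Injective _≡_ _≡_)

weight : {s t : ℕ} → Matrix s t → Transversal s t → ℕ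
weight {s} A (σ , _) = sumFin s (λ i → A i (σ i))

IsTropdet : {s t : ℕ} → Matrix s t → ℕ → Set
IsTropdet A v =
  (∃ λ (T : Transversal _ _) → weight A T ≡ v) ×
  ((T : Transversal _ _) → v ≤ weight A T)

IsU : (k l m n : ℕ) → ℕ → Set
IsU k l m n u =
  (∃ λ (A : Matrix (n * k) (n * l)) → InD k l m n A × IsTropdet A u) ×
  ((A : Matrix (n * k) (n * l)) → InD k l m n A → (v : ℕ) → IsTropdet A v → v ≤ u)

module Submission where

-- Let σ be a minimum-weight transversal of A ∈ 𝒟^{k,l}(m, n), with entries
-- a i = A i (σ i) and weight w.  Neither moving a row to an unused column nor exchanging the
-- columns of two rows lowers w; summing these exchange inequalities over all columns gives,
-- for every row i,  nl · a i + w ≤ (row sum of i) + (column sum of σ i) = m(k + l).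
-- If every a i ≤ q then w ≤ nkq; otherwise some a i ≥ q + 1 and w ≤ nkq + r(k + l) − nl.
--
-- Both extremal matrices are blow-ups  q + B (block i) (block j)  of an n × n
-- pattern B with all line sums r.  If r(k + l) ≤ nl, take B = r·δ: a transversal shifting the
-- blocks cyclically has cost 0.  Otherwise write n = r + e and take the staircase pattern: an
-- explicit shifted transversal costs kr − le, and weak duality with the potentials
-- [block < r] on rows and [block ≥ r] on columns shows that no transversal is cheaper.

open import Defs
open import Data.Nat using (ℕ; _+_; _*_; _∸_; _≤_; _<_; _⊔_)
open import Data.Nat.GCD using (gcd)
open import Relation.Binary.PropositionalEquality using (_≡_)

open import Data.Nat using (zero; suc; z≤n; s≤s; _<?_; _≤?_)
open import Data.Nat.Properties
open import Data.Nat.Tactic.RingSolver using (solve-∀; solve)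
open import Data.List using (_∷_; [])
open import Data.Fin using (Fin; zero; suc; toℕ; _↑ˡ_; _↑ʳ_; combine; quotient; remainder; fromℕ; inject₁; inject≤; fromℕ<)
open import Data.Fin.Properties using (any?; remQuot-combine; combine-remQuot; toℕ-combine; toℕ<n; toℕ-injective; toℕ-fromℕ<; inject≤-injective; combine-injective; fromℕ≢inject₁; inject₁-injective; toℕ-inject₁) renaming (suc-injective to fin-suc-injective; _≟_ to _≟ᶠ_)
open import Data.Fin.Permutation.Components using (transpose; transpose-inverse)
open import Data.Vec.Functional using (updateAt)
open import Data.Vec.Functional.Properties using (updateAt-updates; updateAt-minimal)
open import Data.Product using (∃; _×_; _,_; proj₁; proj₂)
open import Data.Empty using (⊥-elim)
open import Function using (_∘_; case_of_)
open import Function.Definitions using (Injective)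
open import Relation.Nullary using (Dec; does; yes; no; ¬_; ¬?)
open import Data.Bool using (if_then_else_)
open import Relation.Nullary.Decidable using (dec-true; dec-false)
open import Relation.Binary.PropositionalEquality using (refl; sym; trans; cong; cong₂; subst; subst₂; _≢_; module ≡-Reasoning)
open import Algebra.Properties.Semiring.Sum +-*-semiring using (sum; sum-cong-≗; ∑-distrib-+; ∑-comm; *-distribˡ-sum)

-- 𝟙 d : the 0/1 indicator of a decided proposition.  It inspects only the
-- boolean 'does d', so e.g. δ (suc x) (suc y) computes to δ x y.
𝟙 : {P : Set} → Dec P → ℕ
𝟙 d = if does d then 1 else 0

𝟙-yes : {P : Set} → P → (d : Dec P) → 𝟙 d ≡ 1
𝟙-yes p (yes _) = refl
𝟙-yes p (no ¬p) = ⊥-elim (¬p p)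

𝟙-no : {P : Set} → ¬ P → (d : Dec P) → 𝟙 d ≡ 0
𝟙-no ¬p (yes p) = ⊥-elim (¬p p)
𝟙-no ¬p (no _)  = refl

𝟙-complement : {P : Set} (d : Dec P) → 𝟙 d + 𝟙 (¬? d) ≡ 1
𝟙-complement (yes _) = refl
𝟙-complement (no _)  = refl

δ : {n : ℕ} → Fin n → Fin n → ℕ
δ x y = 𝟙 (x ≟ᶠ y)

δ-sym : {n : ℕ} (x y : Fin n) → δ x y ≡ δ y x
δ-sym x y with x ≟ᶠ y | y ≟ᶠ x
... | yes _   | yes _   = refl
... | no _    | no _    = refl
... | yes x≡y | no y≢x  = ⊥-elim (y≢x (sym x≡y))
... | no x≢y  | yes y≡x = ⊥-elim (x≢y (sym y≡x))

δ-refl : {n : ℕ} (x : Fin n) → δ x x ≡ 1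
δ-refl x = 𝟙-yes refl (x ≟ᶠ x)

δ-≢ : {n : ℕ} {x y : Fin n} → x ≢ y → δ x y ≡ 0
δ-≢ {x = x} {y} x≢y = 𝟙-no x≢y (x ≟ᶠ y)

-- Finite sums
-- sumFin agrees with the library's sum over vectors, which lets us reuse
-- the library's congruence, distributivity and interchange laws.

sumFin≡sum : ∀ n (f : Fin n → ℕ) → sumFin n f ≡ sum f
sumFin≡sum zero    f = refl
sumFin≡sum (suc n) f = cong (f zero +_) (sumFin≡sum n (f ∘ suc))

sumFin-cong : ∀ n {f g : Fin n → ℕ} → (∀ i → f i ≡ g i) → sumFin n f ≡ sumFin n g
sumFin-cong n {f} {g} f≗g =
  trans (sumFin≡sum n f) (trans (sum-cong-≗ f≗g) (sym (sumFin≡sum n g)))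

sumFin-+ : ∀ n (f g : Fin n → ℕ) → sumFin n (λ i → f i + g i) ≡ sumFin n f + sumFin n g
sumFin-+ n f g = begin
  sumFin n (λ i → f i + g i)  ≡⟨ sumFin≡sum n _ ⟩
  sum (λ i → f i + g i)       ≡⟨ ∑-distrib-+ f g ⟩
  sum f + sum g               ≡⟨ sym (cong₂ _+_ (sumFin≡sum n f) (sumFin≡sum n g)) ⟩
  sumFin n f + sumFin n g     ∎
  where open ≡-Reasoning

sumFin-* : ∀ n c (f : Fin n → ℕ) → sumFin n (λ i → c * f i) ≡ c * sumFin n f
sumFin-* n c f = begin
  sumFin n (λ i → c * f i)  ≡⟨ sumFin≡sum n _ ⟩
  sum (λ i → c * f i)       ≡⟨ sym (*-distribˡ-sum c f) ⟩
  c * sum f                 ≡⟨ cong (c *_) (sym (sumFin≡sum n f)) ⟩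
  c * sumFin n f            ∎
  where open ≡-Reasoning

sumFin-comm : ∀ a b (F : Fin a → Fin b → ℕ) →
  sumFin a (λ x → sumFin b (F x)) ≡ sumFin b (λ y → sumFin a (λ x → F x y))
sumFin-comm a b F = begin
  sumFin a (λ x → sumFin b (F x))      ≡⟨ sumFin≡sum a _ ⟩
  sum (λ x → sumFin b (F x))           ≡⟨ sum-cong-≗ (λ x → sumFin≡sum b (F x)) ⟩
  sum (λ x → sum (F x))                ≡⟨ ∑-comm F ⟩
  sum (λ y → sum (λ x → F x y))        ≡⟨ sum-cong-≗ (λ y → sym (sumFin≡sum a (λ x → F x y))) ⟩
  sum (λ y → sumFin a (λ x → F x y))   ≡⟨ sym (sumFin≡sum b _) ⟩
  sumFin b (λ y → sumFin a (λ x → F x y)) ∎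
  where open ≡-Reasoning

sumFin-const : ∀ n c → sumFin n (λ _ → c) ≡ n * c
sumFin-const zero    c = refl
sumFin-const (suc n) c = cong (c +_) (sumFin-const n c)

sumFin-mono : ∀ n {f g : Fin n → ℕ} → (∀ i → f i ≤ g i) → sumFin n f ≤ sumFin n g
sumFin-mono zero    f≤g = z≤n
sumFin-mono (suc n) f≤g = +-mono-≤ (f≤g zero) (sumFin-mono n (f≤g ∘ suc))

sumFin-update : ∀ n (f g : Fin n → ℕ) i → (∀ r → r ≢ i → f r ≡ g r) →
  sumFin n f + g i ≡ sumFin n g + f i
sumFin-update (suc n) f g zero agree = begin
  f zero + sumFin n (f ∘ suc) + g zero  ≡⟨ cong (λ s → f zero + s + g zero) tails ⟩
  f zero + sumFin n (g ∘ suc) + g zero  ≡⟨ swap-outer (f zero) _ (g zero) ⟩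
  g zero + sumFin n (g ∘ suc) + f zero  ∎
  where
  open ≡-Reasoning
  swap-outer : ∀ a b c → a + b + c ≡ c + b + a
  swap-outer = solve-∀
  tails : sumFin n (f ∘ suc) ≡ sumFin n (g ∘ suc)
  tails = sumFin-cong n (λ r → agree (suc r) (λ ()))
sumFin-update (suc n) f g (suc i) agree = begin
  f zero + sumFin n (f ∘ suc) + g (suc i)  ≡⟨ +-assoc (f zero) _ _ ⟩
  f zero + (sumFin n (f ∘ suc) + g (suc i)) ≡⟨ cong₂ _+_ (agree zero (λ ())) tails ⟩
  g zero + (sumFin n (g ∘ suc) + f (suc i)) ≡⟨ sym (+-assoc (g zero) _ _) ⟩
  g zero + sumFin n (g ∘ suc) + f (suc i)  ∎
  where
  open ≡-Reasoning
  tails : sumFin n (f ∘ suc) + g (suc i) ≡ sumFin n (g ∘ suc) + f (suc i)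
  tails = sumFin-update n (f ∘ suc) (g ∘ suc) i (λ r r≢i → agree (suc r) (r≢i ∘ fin-suc-injective))

sumFin-update₂ : ∀ n (f g : Fin n → ℕ) i i' → i ≢ i' → (∀ r → r ≢ i → r ≢ i' → f r ≡ g r) →
  sumFin n f + (g i + g i') ≡ sumFin n g + (f i + f i')
sumFin-update₂ n f g i i' i≢i' agree = begin
  sumFin n f + (g i + g i')   ≡⟨ sym (+-assoc _ (g i) (g i')) ⟩
  sumFin n f + g i + g i'     ≡⟨ cong (_+ g i') first ⟩
  sumFin n h + f i + g i'     ≡⟨ +-assoc _ (f i) (g i') ⟩
  sumFin n h + (f i + g i')   ≡⟨ cong (sumFin n h +_) (+-comm (f i) (g i')) ⟩
  sumFin n h + (g i' + f i)   ≡⟨ sym (+-assoc _ (g i') (f i)) ⟩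
  sumFin n h + g i' + f i     ≡⟨ cong (_+ f i) second ⟩
  sumFin n g + f i' + f i     ≡⟨ +-assoc _ (f i') (f i) ⟩
  sumFin n g + (f i' + f i)   ≡⟨ cong (sumFin n g +_) (+-comm (f i') (f i)) ⟩
  sumFin n g + (f i + f i')   ∎
  where
  open ≡-Reasoning
  h : Fin n → ℕ
  h = updateAt f i (λ _ → g i)
  first : sumFin n f + g i ≡ sumFin n h + f i
  first = subst (λ z → sumFin n f + z ≡ sumFin n h + f i) (updateAt-updates i f)
            (sumFin-update n f h i (λ r r≢i → sym (updateAt-minimal r i f r≢i)))
  h≡g : ∀ r → r ≢ i' → h r ≡ g r
  h≡g r r≢i' with r ≟ᶠ i
  ... | yes refl = updateAt-updates i f
  ... | no r≢i   = trans (updateAt-minimal r i f r≢i) (agree r r≢i r≢i')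
  second : sumFin n h + g i' ≡ sumFin n g + f i'
  second = subst (λ z → sumFin n h + g i' ≡ sumFin n g + z) (updateAt-minimal i' i f (i≢i' ∘ sym))
             (sumFin-update n h g i' h≡g)

sumFin-zero : ∀ n → sumFin n (λ _ → 0) ≡ 0
sumFin-zero n = trans (sumFin-const n 0) (*-zeroʳ n)

sumFin-δ : ∀ n (p : Fin n) → sumFin n (δ p) ≡ 1
sumFin-δ (suc n) zero    = cong suc (sumFin-zero n)
sumFin-δ (suc n) (suc p) = sumFin-δ n p

sumFin-count : ∀ n r → r ≤ n → sumFin n (λ b → 𝟙 (toℕ b <? r)) ≡ r
sumFin-count n       zero    _         = sumFin-zero n
sumFin-count (suc n) (suc r) (s≤s r≤n) = cong suc (sumFin-count n r r≤n)

sumFin-count-complement : ∀ n r e → n ≡ r + e → sumFin n (λ c → 𝟙 (¬? (toℕ c <? r))) ≡ e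
sumFin-count-complement n r e n≡r+e = +-cancelˡ-≡ r _ _ (begin
  r + sumFin n high                          ≡⟨ cong (_+ sumFin n high) (sym (sumFin-count n r r≤n)) ⟩
  sumFin n low + sumFin n high               ≡⟨ sym (sumFin-+ n low high) ⟩
  sumFin n (λ c → low c + high c)            ≡⟨ sumFin-cong n (λ c → 𝟙-complement (toℕ c <? r)) ⟩
  sumFin n (λ _ → 1)                         ≡⟨ trans (sumFin-const n 1) (*-identityʳ n) ⟩
  n                                          ≡⟨ n≡r+e ⟩
  r + e                                      ∎)
  where
  open ≡-Reasoning
  low high : Fin n → ℕ
  low  c = 𝟙 (toℕ c <? r)
  high c = 𝟙 (¬? (toℕ c <? r))
  r≤n : r ≤ n
  r≤n = subst (r ≤_) (sym n≡r+e) (m≤m+n r e)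

sumFin-single : ∀ n (f : Fin n → ℕ) i₀ → (∀ i → i ≢ i₀ → f i ≡ 0) → sumFin n f ≡ f i₀
sumFin-single n f i₀ vanish = begin
  sumFin n f                    ≡⟨ sym (+-identityʳ _) ⟩
  sumFin n f + 0                ≡⟨ sumFin-update n f (λ _ → 0) i₀ vanish ⟩
  sumFin n (λ _ → 0) + f i₀     ≡⟨ cong (_+ f i₀) (sumFin-zero n) ⟩
  f i₀                          ∎
  where open ≡-Reasoning

sumFin-++ : ∀ a b (f : Fin (a + b) → ℕ) →
  sumFin (a + b) f ≡ sumFin a (λ i → f (i ↑ˡ b)) + sumFin b (λ j → f (a ↑ʳ j))
sumFin-++ zero    b f = refl
sumFin-++ (suc a) b f =
  trans (cong (f zero +_) (sumFin-++ a b (f ∘ suc))) (sym (+-assoc (f zero) _ _))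

sumFin-combine : ∀ n l (f : Fin (n * l) → ℕ) →
  sumFin (n * l) f ≡ sumFin n (λ c → sumFin l (λ t → f (combine c t)))
sumFin-combine zero    l f = refl
sumFin-combine (suc n) l f =
  trans (sumFin-++ l (n * l) f) (cong (sumFin l (λ t → f (t ↑ˡ n * l)) +_) (sumFin-combine n l (f ∘ (l ↑ʳ_))))

-- push σ f j : the value of f at the σ-preimage of j (0 if j ∉ im σ)
push : {s t : ℕ} → (Fin s → Fin t) → (Fin s → ℕ) → Fin t → ℕ
push {s} σ f j = sumFin s (λ i → f i * δ (σ i) j)

sumFin-push : ∀ s t (σ : Fin s → Fin t) (f : Fin s → ℕ) → sumFin t (push σ f) ≡ sumFin s f
sumFin-push s t σ f = begin
  sumFin t (λ j → sumFin s (λ i → f i * δ (σ i) j)) ≡⟨ sym (sumFin-comm s t _) ⟩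
  sumFin s (λ i → sumFin t (λ j → f i * δ (σ i) j)) ≡⟨ sumFin-cong s pointwise ⟩
  sumFin s f                                        ∎
  where
  open ≡-Reasoning
  pointwise : ∀ i → sumFin t (λ j → f i * δ (σ i) j) ≡ f i
  pointwise i = trans (sumFin-* t (f i) (δ (σ i))) (trans (cong (f i *_) (sumFin-δ t (σ i))) (*-identityʳ (f i)))

push-hit : ∀ {s t} (σ : Fin s → Fin t) → Injective _≡_ _≡_ σ → (f : Fin s → ℕ) →
  ∀ {i₀ j} → σ i₀ ≡ j → push σ f j ≡ f i₀
push-hit {s} σ σ-inj f {i₀} refl = trans (sumFin-single s _ i₀ vanish) (trans (cong (f i₀ *_) (δ-refl (σ i₀))) (*-identityʳ (f i₀)))
  where
  vanish : ∀ i → i ≢ i₀ → f i * δ (σ i) (σ i₀) ≡ 0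
  vanish i i≢i₀ = trans (cong (f i *_) (δ-≢ (i≢i₀ ∘ σ-inj))) (*-zeroʳ (f i))

push-miss : ∀ {s t} (σ : Fin s → Fin t) (f : Fin s → ℕ) →
  ∀ {j} → (∀ i → σ i ≢ j) → push σ f j ≡ 0
push-miss {s} σ f {j} j∉im = trans (sumFin-cong s vanish) (sumFin-zero s)
  where
  vanish : ∀ i → f i * δ (σ i) j ≡ 0
  vanish i = trans (cong (f i *_) (δ-≢ (j∉im i))) (*-zeroʳ (f i))

sumFin-injection : ∀ s t (σ : Fin s → Fin t) → Injective _≡_ _≡_ σ → (g : Fin t → ℕ) →
  sumFin s (g ∘ σ) ≤ sumFin t g
sumFin-injection s t σ σ-inj g = begin
  sumFin s (g ∘ σ)        ≡⟨ sym (sumFin-push s t σ (g ∘ σ)) ⟩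
  sumFin t (push σ (g ∘ σ)) ≤⟨ sumFin-mono t bounded ⟩
  sumFin t g              ∎
  where
  open ≤-Reasoning
  bounded : ∀ j → push σ (g ∘ σ) j ≤ g j
  bounded j with any? (λ i → σ i ≟ᶠ j)
  ... | yes (i₀ , σi₀≡j) = ≤-reflexive (trans (push-hit σ σ-inj (g ∘ σ) σi₀≡j) (cong g σi₀≡j))
  ... | no j∉im          = subst (_≤ g j) (sym (push-miss σ (g ∘ σ) (λ i σi≡j → j∉im (i , σi≡j)))) z≤n

potential-bound : ∀ {s t} (A : Matrix s t) (u : Fin s → ℕ) (v : Fin t → ℕ) →
  (∀ i j → u i ≤ A i j + v j) → (T : Transversal s t) → sumFin s u ≤ weight A T + sumFin t v
potential-bound {s} {t} A u v feasible (τ , τ-inj) = begin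
  sumFin s u                                          ≤⟨ sumFin-mono s (λ i → feasible i (τ i)) ⟩
  sumFin s (λ i → A i (τ i) + v (τ i))                ≡⟨ sumFin-+ s _ _ ⟩
  sumFin s (λ i → A i (τ i)) + sumFin s (v ∘ τ)       ≤⟨ +-monoʳ-≤ _ (sumFin-injection s t τ τ-inj v) ⟩
  sumFin s (λ i → A i (τ i)) + sumFin t v             ∎
  where open ≤-Reasoning

transpose-at : ∀ {n} (i i' : Fin n) → transpose i i' i ≡ i'
transpose-at i i' rewrite dec-true (i ≟ᶠ i) refl = refl

transpose-at′ : ∀ {n} (i i' : Fin n) → transpose i i' i' ≡ i
transpose-at′ i i' with i' ≟ᶠ i
... | yes i'≡i = i'≡i
... | no i'≢i rewrite dec-true (i' ≟ᶠ i') refl = refl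

transpose-off : ∀ {n} (i i' r : Fin n) → r ≢ i → r ≢ i' → transpose i i' r ≡ r
transpose-off i i' r r≢i r≢i' rewrite dec-false (r ≟ᶠ i) r≢i | dec-false (r ≟ᶠ i') r≢i' = refl

transpose-injective : ∀ {n} (i i' : Fin n) → Injective _≡_ _≡_ (transpose i i')
transpose-injective i i' {x} {y} e =
  trans (sym (transpose-inverse i' i)) (trans (cong (transpose i' i) e) (transpose-inverse i' i))

module Optimal {s t : ℕ} (A : Matrix s t) (σ : Fin s → Fin t) (σ-inj : Injective _≡_ _≡_ σ)
               (optimal : (T : Transversal s t) → weight A (σ , σ-inj) ≤ weight A T) where

  a : Fin s → ℕ
  a i = A i (σ i)

  w : ℕ
  w = sumFin s a

  -- an exchange turning σ into τ cannot lower the weight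
  no-improvement : (τ : Transversal s t) {x y : ℕ} → w + y ≡ weight A τ + x → x ≤ y
  no-improvement τ {x} {y} e =
    +-cancelˡ-≤ w x y (≤-trans (+-monoˡ-≤ x (optimal τ)) (≤-reflexive (sym e)))

  move-bound : ∀ i j → (∀ i' → σ i' ≢ j) → a i ≤ A i j
  move-bound i j j-unused = no-improvement (τ , τ-inj) exchange
    where
    τ : Fin s → Fin t
    τ = updateAt σ i (λ _ → j)
    τ-off : ∀ {r} → r ≢ i → τ r ≡ σ r
    τ-off {r} r≢i = updateAt-minimal r i σ r≢i
    τ-inj : Injective _≡_ _≡_ τ
    τ-inj {x} {y} e with x ≟ᶠ i | y ≟ᶠ i
    ... | yes refl | yes refl = refl
    ... | yes refl | no y≢i   = ⊥-elim (j-unused y (trans (sym (τ-off y≢i)) (trans (sym e) (updateAt-updates i σ))))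
    ... | no x≢i   | yes refl = ⊥-elim (j-unused x (trans (sym (τ-off x≢i)) (trans e (updateAt-updates i σ))))
    ... | no x≢i   | no y≢i   = σ-inj (trans (sym (τ-off x≢i)) (trans e (τ-off y≢i)))
    exchange : w + A i j ≡ weight A (τ , τ-inj) + a i
    exchange = subst (λ c → w + A i c ≡ weight A (τ , τ-inj) + a i) (updateAt-updates i σ)
                 (sumFin-update s a (λ r → A r (τ r)) i (λ r r≢i → cong (A r) (sym (τ-off r≢i))))

  swap-bound : ∀ i i' → i ≢ i' → a i + a i' ≤ A i (σ i') + A i' (σ i)
  swap-bound i i' i≢i' = no-improvement (τ , τ-inj) exchange
    where
    τ : Fin s → Fin t
    τ = σ ∘ transpose i i'
    τ-inj : Injective _≡_ _≡_ τ
    τ-inj = transpose-injective i i' ∘ σ-inj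
    exchange : w + (A i (σ i') + A i' (σ i)) ≡ weight A (τ , τ-inj) + (a i + a i')
    exchange = subst₂ (λ c c' → w + (A i c + A i' c') ≡ weight A (τ , τ-inj) + (a i + a i'))
                 (cong σ (transpose-at i i')) (cong σ (transpose-at′ i i'))
                 (sumFin-update₂ s a (λ r → A r (τ r)) i i' i≢i'
                   (λ r r≢i r≢i' → cong (A r ∘ σ) (sym (transpose-off i i' r r≢i r≢i'))))

  -- both exchanges at once, column by column: for a row i and a column j = σ i',
  -- a i + a i' ≤ A i j + A i' (σ i); for a column j outside the image, a i ≤ A i j
  exchange-bound : ∀ i j → a i + push σ a j ≤ A i j + push σ (λ i' → A i' (σ i)) j
  exchange-bound i j with any? (λ i' → σ i' ≟ᶠ j)
  ... | yes (i' , σi'≡j) =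
    subst₂ (λ x y → a i + x ≤ A i j + y) (sym (push-hit σ σ-inj a σi'≡j))
           (sym (push-hit σ σ-inj (λ i'' → A i'' (σ i)) σi'≡j)) (subst (λ c → a i + a i' ≤ A i c + A i' (σ i)) σi'≡j pair)
    where
    pair : a i + a i' ≤ A i (σ i') + A i' (σ i)
    pair with i ≟ᶠ i'
    ... | yes refl = ≤-refl
    ... | no i≢i'  = swap-bound i i' i≢i'
  ... | no j∉im =
    subst₂ (λ x y → a i + x ≤ A i j + y) (sym (push-miss σ a unused))
           (sym (push-miss σ (λ i'' → A i'' (σ i)) unused)) (+-monoˡ-≤ 0 (move-bound i j unused))
    where
    unused : ∀ i' → σ i' ≢ j
    unused i' σi'≡j = j∉im (i' , σi'≡j)

  row-bound : ∀ i → t * a i + w ≤ sumFin t (A i) + sumFin s (λ i' → A i' (σ i))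
  row-bound i = begin
    t * a i + w
      ≡⟨ sym (cong₂ _+_ (sumFin-const t (a i)) (sumFin-push s t σ a)) ⟩
    sumFin t (λ _ → a i) + sumFin t (push σ a)
      ≡⟨ sym (sumFin-+ t _ _) ⟩
    sumFin t (λ j → a i + push σ a j)
      ≤⟨ sumFin-mono t (exchange-bound i) ⟩
    sumFin t (λ j → A i j + push σ (λ i' → A i' (σ i)) j)
      ≡⟨ sumFin-+ t _ _ ⟩
    sumFin t (A i) + sumFin t (push σ (λ i' → A i' (σ i)))
      ≡⟨ cong (sumFin t (A i) +_) (sumFin-push s t σ _) ⟩
    sumFin t (A i) + sumFin s (λ i' → A i' (σ i)) ∎
    where open ≤-Reasoning

-- the arithmetic behind the case "some entry of the optimal transversal exceeds q"
large-entry-bound : ∀ n k l q r x w → q < x →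
  n * l * x + w ≤ (q * n + r) * l + (q * n + r) * k → w ≤ (n * k * q + r * (k + l)) ∸ n * l
large-entry-bound n k l q r x w q<x row = subst (_≤ _) (m+n∸m≡n (n * l) w) (∸-monoˡ-≤ (n * l) cancelled)
  where
  lhs : n * l * suc q + w ≡ n * l * q + (n * l + w)
  lhs = solve (n ∷ l ∷ q ∷ w ∷ [])
  rhs : (q * n + r) * l + (q * n + r) * k ≡ n * l * q + (n * k * q + r * (k + l))
  rhs = solve (n ∷ k ∷ l ∷ q ∷ r ∷ [])
  cancelled : n * l + w ≤ n * k * q + r * (k + l)
  cancelled = +-cancelˡ-≤ (n * l * q) _ _
    (subst₂ _≤_ lhs rhs (≤-trans (+-monoˡ-≤ w (*-monoʳ-≤ (n * l) q<x)) row))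

-- Take a minimum-weight transversal σ.  If all its entries are ≤ q its weight is ≤ nkq;
-- otherwise row-bound at an entry > q gives the second bound.
upper-bound : ∀ k l n q r (A : Matrix (n * k) (n * l)) → InD k l (q * n + r) n A →
  ∀ v → IsTropdet A v → v ≤ (n * k * q) ⊔ ((n * k * q + r * (k + l)) ∸ n * l)
upper-bound k l n q r A (rows , cols) v (((σ , σ-inj) , σ-weight) , minimal) =
  subst (_≤ _) σ-weight bound
  where
  open Optimal A σ σ-inj (λ T → subst (_≤ weight A T) (sym σ-weight) (minimal T))
  bound : w ≤ (n * k * q) ⊔ ((n * k * q + r * (k + l)) ∸ n * l)
  bound with any? (λ i → q <? a i)
  ... | yes (i , q<ai) = ≤-trans (large-entry-bound n k l q r (a i) w q<ai row) (m≤n⊔m _ _)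
    where
    row : n * l * a i + w ≤ (q * n + r) * l + (q * n + r) * k
    row = subst (n * l * a i + w ≤_) (cong₂ _+_ (rows i) (cols (σ i))) (row-bound i)
  ... | no none-large = ≤-trans small (m≤m⊔n _ _)
    where
    small : w ≤ n * k * q
    small = subst (w ≤_) (sumFin-const (n * k) q)
              (sumFin-mono (n * k) (λ i → ≮⇒≥ (λ q<ai → none-large (i , q<ai))))

block : ∀ n l → Fin (n * l) → Fin n
block n l = quotient {n} l

offset : ∀ n l → Fin (n * l) → Fin l
offset n l = remainder {n} l

block-combine : ∀ {n} l (c : Fin n) (t : Fin l) → block n l (combine c t) ≡ c
block-combine l c t = cong proj₁ (remQuot-combine c t)

sumFin-blocks : ∀ n l (G : Fin n → ℕ) → sumFin (n * l) (λ j → G (block n l j)) ≡ l * sumFin n G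
sumFin-blocks n l G = begin
  sumFin (n * l) (λ j → G (block n l j))
    ≡⟨ sumFin-combine n l _ ⟩
  sumFin n (λ c → sumFin l (λ t → G (block n l (combine c t))))
    ≡⟨ sumFin-cong n (λ c → sumFin-cong l (λ t → cong G (block-combine l c t))) ⟩
  sumFin n (λ c → sumFin l (λ _ → G c))
    ≡⟨ sumFin-cong n (λ c → sumFin-const l (G c)) ⟩
  sumFin n (λ c → l * G c)
    ≡⟨ sumFin-* n l G ⟩
  l * sumFin n G ∎
  where open ≡-Reasoning

toℕ-block : ∀ n k (i : Fin (n * k)) → toℕ i ≡ k * toℕ (block n k i) + toℕ (offset n k i)
toℕ-block n k i = trans (cong toℕ (sym (combine-remQuot {n} k i))) (toℕ-combine (block n k i) (offset n k i))

low-block⇒ : ∀ n k r (i : Fin (n * k)) → toℕ (block n k i) < r → toℕ i < k * r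
low-block⇒ n k r i b<r = begin-strict
  toℕ i                                       ≡⟨ toℕ-block n k i ⟩
  k * toℕ (block n k i) + toℕ (offset n k i)  <⟨ +-monoʳ-< _ (toℕ<n (offset n k i)) ⟩
  k * toℕ (block n k i) + k                   ≡⟨ trans (+-comm _ k) (sym (*-suc k _)) ⟩
  k * suc (toℕ (block n k i))                 ≤⟨ *-monoʳ-≤ k b<r ⟩
  k * r                                       ∎
  where open ≤-Reasoning

low-block⇐ : ∀ n k r (i : Fin (n * k)) → toℕ i < k * r → toℕ (block n k i) < r
low-block⇐ n k r i i<kr = ≰⇒> λ r≤b → <⇒≱ i<kr (begin
  k * r                                       ≤⟨ *-monoʳ-≤ k r≤b ⟩
  k * toℕ (block n k i)                       ≤⟨ m≤m+n _ _ ⟩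
  k * toℕ (block n k i) + toℕ (offset n k i)  ≡⟨ sym (toℕ-block n k i) ⟩
  toℕ i                                       ∎)
  where open ≤-Reasoning

module BlowUp (k l n q : ℕ) (B : Fin n → Fin n → ℕ) where

  rowBlock : Fin (n * k) → Fin n
  rowBlock = block n k

  colBlock : Fin (n * l) → Fin n
  colBlock = block n l

  blowUp : Matrix (n * k) (n * l)
  blowUp i j = q + B (rowBlock i) (colBlock j)

  cost : Transversal (n * k) (n * l) → ℕ
  cost (τ , _) = sumFin (n * k) (λ i → B (rowBlock i) (colBlock (τ i)))

  weight-blowUp : (T : Transversal (n * k) (n * l)) → weight blowUp T ≡ n * k * q + cost T
  weight-blowUp T = trans (sumFin-+ (n * k) _ _) (cong (_+ cost T) (sumFin-const (n * k) q))

  blowUp-InD : ∀ r → (∀ b → sumFin n (B b) ≡ r) → (∀ c → sumFin n (λ b → B b c) ≡ r) →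
    InD k l (q * n + r) n blowUp
  blowUp-InD r rowSum colSum = rows , cols
    where
    rows : ∀ i → sumFin (n * l) (blowUp i) ≡ (q * n + r) * l
    rows i = begin
      sumFin (n * l) (blowUp i)                                          ≡⟨ sumFin-+ (n * l) _ _ ⟩
      sumFin (n * l) (λ _ → q) + sumFin (n * l) (λ j → B (rowBlock i) (colBlock j))
        ≡⟨ cong₂ _+_ (sumFin-const (n * l) q) (trans (sumFin-blocks n l (B (rowBlock i))) (cong (l *_) (rowSum (rowBlock i)))) ⟩
      n * l * q + l * r                                                  ≡⟨ solve (n ∷ l ∷ q ∷ r ∷ []) ⟩
      (q * n + r) * l                                                    ∎
      where open ≡-Reasoning
    cols : ∀ j → sumFin (n * k) (λ i → blowUp i j) ≡ (q * n + r) * k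
    cols j = begin
      sumFin (n * k) (λ i → blowUp i j)                                  ≡⟨ sumFin-+ (n * k) _ _ ⟩
      sumFin (n * k) (λ _ → q) + sumFin (n * k) (λ i → B (rowBlock i) (colBlock j))
        ≡⟨ cong₂ _+_ (sumFin-const (n * k) q) (trans (sumFin-blocks n k (λ b → B b (colBlock j))) (cong (k *_) (colSum (colBlock j)))) ⟩
      n * k * q + k * r                                                  ≡⟨ solve (n ∷ k ∷ q ∷ r ∷ []) ⟩
      (q * n + r) * k                                                    ∎
      where open ≡-Reasoning

  blowUp-tropdet : (T : Transversal (n * k) (n * l)) → ((T' : Transversal (n * k) (n * l)) → cost T ≤ cost T') →
    IsTropdet blowUp (n * k * q + cost T)
  blowUp-tropdet T minimal =
    (T , weight-blowUp T) ,
    λ T' → subst (n * k * q + cost T ≤_) (sym (weight-blowUp T')) (+-monoʳ-≤ (n * k * q) (minimal T'))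

-- The construction for r(k + l) ≤ nl
-- The pattern r·δ (r on the diagonal blocks) has tropical determinant 0:
-- a transversal can avoid the diagonal blocks by shifting every block cyclically.

cyc : ∀ {n} → Fin n → Fin n
cyc {suc n} zero    = fromℕ n
cyc {suc n} (suc i) = inject₁ i

cyc-injective : ∀ {n} → Injective _≡_ _≡_ (cyc {n})
cyc-injective {suc n} {zero}  {zero}  e = refl
cyc-injective {suc n} {zero}  {suc j} e = ⊥-elim (fromℕ≢inject₁ e)
cyc-injective {suc n} {suc i} {zero}  e = ⊥-elim (fromℕ≢inject₁ (sym e))
cyc-injective {suc n} {suc i} {suc j} e = cong suc (inject₁-injective e)

cyc-derangement : ∀ {n} → 2 ≤ n → (b : Fin n) → cyc b ≢ b
cyc-derangement {suc (suc n)} _         zero    ()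
cyc-derangement {suc zero}    (s≤s ()) zero
cyc-derangement {suc n}       _         (suc i) e = 1+n≢n (sym (trans (sym (toℕ-inject₁ i)) (cong toℕ e)))

-- an r·δ-entry on the cyclically shifted block vanishes (if r > 0 then n ≥ 2)
shifted-off-diagonal : ∀ {n} r → r < n → (b : Fin n) → r * δ b (cyc b) ≡ 0
shifted-off-diagonal zero    _   b = refl
shifted-off-diagonal (suc r) r<n b =
  trans (cong (suc r *_) (δ-≢ (cyc-derangement (≤-trans (s≤s (s≤s z≤n)) r<n) b ∘ sym))) (*-zeroʳ (suc r))

diagonal-construction : ∀ k l n q r → k ≤ l → r < n →
  ∃ λ (A : Matrix (n * k) (n * l)) → InD k l (q * n + r) n A × IsTropdet A (n * k * q)
diagonal-construction k l n q r k≤l r<n =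
  blowUp , blowUp-InD r rowSum colSum ,
  subst (IsTropdet blowUp) (trans (cong (n * k * q +_) σ-cost) (+-identityʳ _))
    (blowUp-tropdet σ (λ T → subst (_≤ cost T) (sym σ-cost) z≤n))
  where
  open BlowUp k l n q (λ b c → r * δ b c)
  rowSum : ∀ b → sumFin n (λ c → r * δ b c) ≡ r
  rowSum b = trans (sumFin-* n r (δ b)) (trans (cong (r *_) (sumFin-δ n b)) (*-identityʳ r))
  colSum : ∀ c → sumFin n (λ b → r * δ b c) ≡ r
  colSum c = trans (sumFin-cong n (λ b → cong (r *_) (δ-sym b c))) (rowSum c)
  τ : Fin (n * k) → Fin (n * l)
  τ i = combine (cyc (block n k i)) (inject≤ (offset n k i) k≤l)
  τ-inj : Injective _≡_ _≡_ τ
  τ-inj {x} {y} e = trans (sym (combine-remQuot {n} k x)) (trans (cong₂ combine same-block same-offset) (combine-remQuot {n} k y))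
    where
    parts = combine-injective _ _ _ _ e
    same-block : block n k x ≡ block n k y
    same-block = cyc-injective (proj₁ parts)
    same-offset : offset n k x ≡ offset n k y
    same-offset = inject≤-injective k≤l k≤l _ _ (proj₂ parts)
  σ : Transversal (n * k) (n * l)
  σ = τ , τ-inj
  σ-cost : cost σ ≡ 0
  σ-cost = trans (sumFin-cong (n * k) vanish) (sumFin-zero (n * k))
    where
    vanish : ∀ i → r * δ (block n k i) (block n l (τ i)) ≡ 0
    vanish i = trans (cong (λ c → r * δ (block n k i) c) (block-combine l _ _)) (shifted-off-diagonal r r<n (block n k i))

staircase : ∀ {n} r → Fin n → Fin n → ℕ
staircase r b c with toℕ b <? r
... | yes _ = 𝟙 (toℕ c <? r)
... | no _  = r * δ b c

module _ {n : ℕ} (r : ℕ) where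

  across-vanishes : {b c : Fin n} → toℕ c < r → ¬ toℕ b < r → r * δ b c ≡ 0
  across-vanishes c<r b≮r =
    trans (cong (r *_) (δ-≢ (λ b≡c → b≮r (subst (λ x → toℕ x < r) (sym b≡c) c<r)))) (*-zeroʳ r)

  staircase-low-row : {b c : Fin n} → toℕ b < r → staircase r b c ≡ 𝟙 (toℕ c <? r)
  staircase-low-row {b} b<r with toℕ b <? r
  ... | yes _   = refl
  ... | no b≮r  = ⊥-elim (b≮r b<r)

  staircase-high-row : {b c : Fin n} → ¬ toℕ b < r → staircase r b c ≡ r * δ b c
  staircase-high-row {b} b≮r with toℕ b <? r
  ... | yes b<r = ⊥-elim (b≮r b<r)
  ... | no _    = refl

  staircase-low-col : {b c : Fin n} → toℕ c < r → staircase r b c ≡ 𝟙 (toℕ b <? r)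
  staircase-low-col {b} {c} c<r with toℕ b <? r
  ... | yes b<r = trans (𝟙-yes c<r (toℕ c <? r)) (sym (𝟙-yes b<r (toℕ b <? r)))
  ... | no b≮r  = trans (across-vanishes c<r b≮r) (sym (𝟙-no b≮r (toℕ b <? r)))

  staircase-high-col : {b c : Fin n} → ¬ toℕ c < r → staircase r b c ≡ r * δ b c
  staircase-high-col {b} {c} c≮r with toℕ b <? r
  ... | yes b<r = trans (𝟙-no c≮r (toℕ c <? r)) (sym (trans (cong (r *_) (δ-sym b c)) (across-vanishes b<r c≮r)))
  ... | no _    = refl

  staircase-rowSum : r ≤ n → ∀ b → sumFin n (staircase r b) ≡ r
  staircase-rowSum r≤n b = case toℕ b <? r of λ where
    (yes b<r) → trans (sumFin-cong n (λ c → staircase-low-row {c = c} b<r)) (sumFin-count n r r≤n)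
    (no b≮r)  → trans (sumFin-cong n (λ c → staircase-high-row {c = c} b≮r))
                   (trans (sumFin-* n r (δ b)) (trans (cong (r *_) (sumFin-δ n b)) (*-identityʳ r)))

  staircase-colSum : r ≤ n → ∀ c → sumFin n (λ b → staircase r b c) ≡ r
  staircase-colSum r≤n c = case toℕ c <? r of λ where
    (yes c<r) → trans (sumFin-cong n (λ b → staircase-low-col {b = b} c<r)) (sumFin-count n r r≤n)
    (no c≮r)  → trans (sumFin-cong n (λ b → trans (staircase-high-col {b = b} c≮r) (cong (r *_) (δ-sym b c))))
                   (trans (sumFin-* n r (δ c)) (trans (cong (r *_) (sumFin-δ n c)) (*-identityʳ r)))

  -- dual feasibility: row potential [b < r], column potential [c ≥ r]
  staircase-potential : ∀ b c → 𝟙 (toℕ b <? r) ≤ staircase r b c + 𝟙 (¬? (toℕ c <? r))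
  staircase-potential b c = case toℕ b <? r of λ where
    (no b≮r)  → subst (_≤ staircase r b c + 𝟙 (¬? (toℕ c <? r))) (sym (𝟙-no b≮r (toℕ b <? r))) z≤n
    -- for b < r both sides equal 1 = [c < r] + [c ≥ r]
    (yes b<r) → ≤-reflexive (trans (𝟙-yes b<r (toℕ b <? r))
                  (trans (sym (𝟙-complement (toℕ c <? r))) (cong (_+ 𝟙 (¬? (toℕ c <? r))) (sym (staircase-low-row {c = c} b<r)))))

-- The optimal transversal for the blown-up staircase, when n = r + e and le < kr:
-- row i goes to column i + lr if i < le, and to column i − le otherwise.
module Shift (k l n r e : ℕ) (n≡r+e : n ≡ r + e) (le<kr : l * e < k * r) (k≤l : k ≤ l) where

  nl≡lr+le : n * l ≡ l * r + l * e
  nl≡lr+le = trans (cong (_* l) n≡r+e) (solve (r ∷ e ∷ l ∷ []))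

  row<nl : (i : Fin (n * k)) → toℕ i < n * l
  row<nl i = <-≤-trans (toℕ<n i) (*-monoʳ-≤ n k≤l)

  shift : Fin (n * k) → Fin (n * l)
  shift i with toℕ i <? l * e
  ... | yes i<le = fromℕ< (subst (toℕ i + l * r <_) (trans (+-comm (l * e) (l * r)) (sym nl≡lr+le)) (+-monoˡ-< (l * r) i<le))
  ... | no _     = fromℕ< (≤-<-trans (m∸n≤m (toℕ i) (l * e)) (row<nl i))

  shift-low : ∀ i → toℕ i < l * e → toℕ (shift i) ≡ toℕ i + l * r
  shift-low i i<le with toℕ i <? l * e
  ... | yes _    = toℕ-fromℕ< _
  ... | no i≮le  = ⊥-elim (i≮le i<le)

  shift-high : ∀ i → ¬ toℕ i < l * e → toℕ (shift i) ≡ toℕ i ∸ l * e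
  shift-high i i≮le with toℕ i <? l * e
  ... | yes i<le = ⊥-elim (i≮le i<le)
  ... | no _     = toℕ-fromℕ< _

  shift-low-≥ : ∀ i → toℕ i < l * e → l * r ≤ toℕ (shift i)
  shift-low-≥ i i<le = subst (l * r ≤_) (sym (shift-low i i<le)) (m≤n+m (l * r) (toℕ i))

  shift-high-< : ∀ i → ¬ toℕ i < l * e → toℕ (shift i) < l * r
  shift-high-< i i≮le = subst (_< l * r) (sym (shift-high i i≮le))
    (subst (toℕ i ∸ l * e <_) (trans (cong (_∸ l * e) nl≡lr+le) (m+n∸n≡m (l * r) (l * e)))
      (∸-monoˡ-< (row<nl i) (≮⇒≥ i≮le)))

  shift-injective : Injective _≡_ _≡_ shift
  shift-injective {x} {y} same = by-cases (toℕ x <? l * e) (toℕ y <? l * e)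
    where
    by-cases : Dec (toℕ x < l * e) → Dec (toℕ y < l * e) → x ≡ y
    by-cases (yes x<) (yes y<) = toℕ-injective (+-cancelʳ-≡ (l * r) _ _
      (trans (sym (shift-low x x<)) (trans (cong toℕ same) (shift-low y y<))))
    by-cases (yes x<) (no y≮) = ⊥-elim (<⇒≱ (shift-high-< y y≮) (subst (l * r ≤_) (cong toℕ same) (shift-low-≥ x x<)))
    by-cases (no x≮) (yes y<) = ⊥-elim (<⇒≱ (shift-high-< x x≮) (subst (l * r ≤_) (cong toℕ (sym same)) (shift-low-≥ y y<)))
    by-cases (no x≮) (no y≮)  = toℕ-injective (∸-cancelʳ-≡ (≮⇒≥ x≮) (≮⇒≥ y≮)
      (trans (sym (shift-high x x≮)) (trans (cong toℕ same) (shift-high y y≮))))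

  -- row-by-row cost of shift: it pays 1 exactly for the rows le ≤ i < kr
  shift-cost-row : ∀ i → staircase r (block n k i) (block n l (shift i)) + 𝟙 (toℕ i <? l * e) ≡ 𝟙 (toℕ i <? k * r)
  shift-cost-row i = by-cases (toℕ i <? k * r) (toℕ i <? l * e)
    where
    b = block n k i
    c = block n l (shift i)
    by-cases : Dec (toℕ i < k * r) → Dec (toℕ i < l * e) →
               staircase r b c + 𝟙 (toℕ i <? l * e) ≡ 𝟙 (toℕ i <? k * r)
    -- i < le: low row block, high column block; 0 + 1 = 1
    by-cases _ (yes i<le) = trans
      (cong₂ _+_ (trans (staircase-low-row r b<r) (𝟙-no c≮r (toℕ c <? r))) (𝟙-yes i<le (toℕ i <? l * e)))
      (sym (𝟙-yes i<kr (toℕ i <? k * r)))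
      where
      i<kr = <-trans i<le le<kr
      b<r = low-block⇐ n k r i i<kr
      c≮r = λ c<r → <⇒≱ (low-block⇒ n l r (shift i) c<r) (shift-low-≥ i i<le)
    -- le ≤ i < kr: low row block, low column block; 1 + 0 = 1
    by-cases (yes i<kr) (no i≮le) = trans
      (cong₂ _+_ (trans (staircase-low-row r b<r) (𝟙-yes c<r (toℕ c <? r))) (𝟙-no i≮le (toℕ i <? l * e)))
      (sym (𝟙-yes i<kr (toℕ i <? k * r)))
      where
      b<r = low-block⇐ n k r i i<kr
      c<r = low-block⇐ n l r (shift i) (shift-high-< i i≮le)
    -- kr ≤ i: high row block, low column block; 0 + 0 = 0
    by-cases (no i≮kr) (no i≮le) = trans
      (cong₂ _+_ (trans (staircase-high-row r b≮r) (across-vanishes r c<r b≮r)) (𝟙-no i≮le (toℕ i <? l * e)))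
      (sym (𝟙-no i≮kr (toℕ i <? k * r)))
      where
      b≮r = λ b<r → i≮kr (low-block⇒ n k r i b<r)
      c<r = low-block⇐ n l r (shift i) (shift-high-< i i≮le)

  shift-cost : sumFin (n * k) (λ i → staircase r (block n k i) (block n l (shift i))) + l * e ≡ k * r
  shift-cost = begin
    sumFin (n * k) rowCost + l * e
      ≡⟨ cong (sumFin (n * k) rowCost +_) (sym (sumFin-count (n * k) (l * e) (≤-trans (<⇒≤ le<kr) kr≤nk))) ⟩
    sumFin (n * k) rowCost + sumFin (n * k) (λ i → 𝟙 (toℕ i <? l * e))
      ≡⟨ sym (sumFin-+ (n * k) _ _) ⟩
    sumFin (n * k) (λ i → rowCost i + 𝟙 (toℕ i <? l * e))
      ≡⟨ sumFin-cong (n * k) shift-cost-row ⟩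
    sumFin (n * k) (λ i → 𝟙 (toℕ i <? k * r))
      ≡⟨ sumFin-count (n * k) (k * r) kr≤nk ⟩
    k * r ∎
    where
    open ≡-Reasoning
    rowCost : Fin (n * k) → ℕ
    rowCost i = staircase r (block n k i) (block n l (shift i))
    kr≤nk : k * r ≤ n * k
    kr≤nk = subst (k * r ≤_) (*-comm k n) (*-monoʳ-≤ k (subst (r ≤_) (sym n≡r+e) (m≤m+n r e)))

staircase-construction : ∀ k l n q r e → k ≤ l → n ≡ r + e → l * e < k * r →
  ∃ λ (A : Matrix (n * k) (n * l)) → InD k l (q * n + r) n A × IsTropdet A (n * k * q + (k * r ∸ l * e))
staircase-construction k l n q r e k≤l n≡r+e le<kr =
  blowUp , blowUp-InD r (staircase-rowSum r r≤n) (staircase-colSum r r≤n) ,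
  subst (λ v → IsTropdet blowUp (n * k * q + v)) σ-cost
    (blowUp-tropdet σ (λ T → subst (_≤ cost T) (sym σ-cost) (minimal T)))
  where
  open BlowUp k l n q (staircase r)
  open Shift k l n r e n≡r+e le<kr k≤l
  r≤n : r ≤ n
  r≤n = subst (r ≤_) (sym n≡r+e) (m≤m+n r e)
  σ : Transversal (n * k) (n * l)
  σ = shift , shift-injective
  σ-cost : cost σ ≡ k * r ∸ l * e
  σ-cost = trans (sym (m+n∸n≡m (cost σ) (l * e))) (cong (_∸ l * e) shift-cost)
  -- weak duality with the potentials of staircase-potential
  minimal : (T : Transversal (n * k) (n * l)) → k * r ∸ l * e ≤ cost T
  minimal (τ , τ-inj) = subst (k * r ∸ l * e ≤_) (m+n∸n≡m (cost (τ , τ-inj)) (l * e)) (∸-monoˡ-≤ (l * e) duality)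
    where
    duality : k * r ≤ cost (τ , τ-inj) + l * e
    duality = subst₂ (λ x y → x ≤ cost (τ , τ-inj) + y)
      (trans (sumFin-blocks n k _) (cong (k *_) (sumFin-count n r r≤n)))
      (trans (sumFin-blocks n l _) (cong (l *_) (sumFin-count-complement n r e n≡r+e)))
      (potential-bound (λ i j → staircase r (rowBlock i) (colBlock j))
        (λ i → 𝟙 (toℕ (rowBlock i) <? r)) (λ j → 𝟙 (¬? (toℕ (colBlock j) <? r)))
        (λ i j → staircase-potential r (rowBlock i) (colBlock j)) (τ , τ-inj))

bound-small : ∀ a x y → x ≤ y → a ⊔ (a + x ∸ y) ≡ a
bound-small a x y x≤y = m≥n⇒m⊔n≡m (≤-trans (∸-monoˡ-≤ y (+-monoʳ-≤ a x≤y)) (≤-reflexive (m+n∸n≡m a y)))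

bound-large : ∀ a k l n r e → n ≡ r + e → l * e ≤ k * r → a ⊔ (a + r * (k + l) ∸ n * l) ≡ a + (k * r ∸ l * e)
bound-large a k l n r e refl le≤kr = begin
  a ⊔ (a + r * (k + l) ∸ (r + e) * l)           ≡⟨ cong₂ (λ x y → a ⊔ (x ∸ y)) total nl≡ ⟩
  a ⊔ (l * r + (a + k * r) ∸ (l * r + l * e))   ≡⟨ cong (a ⊔_) ([m+n]∸[m+o]≡n∸o (l * r) (a + k * r) (l * e)) ⟩
  a ⊔ (a + k * r ∸ l * e)                       ≡⟨ cong (a ⊔_) (+-∸-assoc a le≤kr) ⟩
  a ⊔ (a + (k * r ∸ l * e))                     ≡⟨ m≤n⇒m⊔n≡n (m≤m+n a _) ⟩
  a + (k * r ∸ l * e)                           ∎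
  where
  open ≡-Reasoning
  total : a + r * (k + l) ≡ l * r + (a + k * r)
  total = solve (a ∷ k ∷ l ∷ r ∷ [])
  nl≡ : (r + e) * l ≡ l * r + l * e
  nl≡ = solve (r ∷ e ∷ l ∷ [])

large-threshold : ∀ k l n r e → n ≡ r + e → n * l < r * (k + l) → l * e < k * r
large-threshold k l n r e refl nl<r[k+l] = +-cancelˡ-< (l * r) (l * e) (k * r)
  (subst₂ _<_ nl≡ r[k+l]≡ nl<r[k+l])
  where
  nl≡ : (r + e) * l ≡ l * r + l * e
  nl≡ = solve (r ∷ e ∷ l ∷ [])
  r[k+l]≡ : r * (k + l) ≡ l * r + k * r
  r[k+l]≡ = solve (r ∷ k ∷ l ∷ [])

mainTheorem13 : (k l n m q r : ℕ) → 1 ≤ k → k ≤ l → gcd k l ≡ 1 → 1 ≤ n →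
    m ≡ q * n + r → r < n →
    IsU k l m n ((n * k * q) ⊔ ((n * k * q + r * (k + l)) ∸ n * l))
mainTheorem13 k l n m q r _ k≤l _ _ refl r<n = attained , upper-bound k l n q r
  where
  Attains : ℕ → Set
  Attains u = ∃ λ (A : Matrix (n * k) (n * l)) → InD k l (q * n + r) n A × IsTropdet A u
  attained : Attains ((n * k * q) ⊔ ((n * k * q + r * (k + l)) ∸ n * l))
  attained with r * (k + l) ≤? n * l
  ... | yes small = subst Attains (sym (bound-small (n * k * q) _ _ small))
                      (diagonal-construction k l n q r k≤l r<n)
  ... | no large  = subst Attains (sym (bound-large (n * k * q) k l n r e n≡r+e (<⇒≤ le<kr)))
                      (staircase-construction k l n q r e k≤l n≡r+e le<kr)
    where
    e = n ∸ r
    n≡r+e : n ≡ r + e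
    n≡r+e = sym (m+[n∸m]≡n (<⇒≤ r<n))
    le<kr : l * e < k * r
    le<kr = large-threshold k l n r e n≡r+e (≰⇒> large)
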